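{- Let $\mathcal{V}$ be a quantaloid and let $p:\mathbb{A}\to\mathbb{B}$, $f:\mathbb{B}\to\mathbb{C}$, $g:\mathbb{A}\to\mathbb{C}$ be $\mathcal{V}$-functors with $g=f\circ p$. If $g\in\mathbb{O}\mathrm{d}$ and $p$ is surjective on objects, then $f\in\mathbb{O}\mathrm{d}$.
   Context: A quantaloid $\mathcal{V}$ is a small, locally ordered bicategory whose hom-posets are complete lattices and which is biclosed (for every arrow $f$, $-\otimes f$ and $f\otimes -$ have right adjoints, $\otimes$ = horizontal composition in diagrammatic order). A $\mathcal{V}$-category $\mathbb{A}$: a set $\mathrm{Obj}(\mathbb{A})$, a map $a\mapsto a_+\in\mathrm{Obj}(\mathcal{V})$, arrows $\mathbb{A}(a,b):a_+\to b_+$ with $id_{a_+}\le\mathbb{A}(a,a)$, $\mathbb{A}(a,b)\otimes\mathbb{A}(b,c)\le\mathbb{A}(a,c)$. A $\mathcal{V}$-functor $f:\mathbb{A}\to\mathbb{B}$: a map on objects with $(fa)_+=a_+$ and $\mathbb{A}(a,a')\le\mathbb{B}(fa,fa')$. A functional bisimulation is a $\mathcal{V}$-functor $f:\mathbb{A}\to\mathbb{B}$ with $\mathbb{B}(f(a),b)=\bigvee_{a':f(a')=b}\mathbb{A}(a,a')$ for all $a,b$; $\mathbb{O}\mathrm{d}$ is the class of functional bisimulations surjective on objects. -}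

module Defs where

open import Level using (Level; _⊔_) renaming (suc to lsuc)
open import Data.Product using (Σ; _,_; _×_)
open import Relation.Binary.PropositionalEquality using (_≡_; refl; sym; trans; cong; subst₂)
open import Relation.Binary.Structures using (IsPartialOrder)
open import Function.Base using (_∘_)

-- Since 2-cells are the order, which
-- is antisymmetric, associativity/unit laws hold up to equality.
-- Composition _⊗_ is written in diagrammatic order.

record Quantaloid (o h ℓ ι : Level) : Set (lsuc (o ⊔ h ⊔ ℓ ⊔ ι)) where
  infixr 7 _⊗_
  infix 4 _≤_
  field
    Ob   : Set o
    Hom  : Ob → Ob → Set h
    _≤_  : ∀ {x y} → Hom x y → Hom x y → Set ℓ
    ≤-isPartialOrder : ∀ {x y} → IsPartialOrder (_≡_ {A = Hom x y}) _≤_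
    ⋁       : ∀ {x y} {I : Set ι} → (I → Hom x y) → Hom x y
    ⋁-upper : ∀ {x y} {I : Set ι} (F : I → Hom x y) (i : I) → F i ≤ ⋁ F
    ⋁-least : ∀ {x y} {I : Set ι} (F : I → Hom x y) (u : Hom x y) →
              (∀ i → F i ≤ u) → ⋁ F ≤ u
    idₕ  : ∀ x → Hom x x
    _⊗_  : ∀ {x y z} → Hom x y → Hom y z → Hom x z
    ⊗-mono  : ∀ {x y z} {f f' : Hom x y} {g g' : Hom y z} →
              f ≤ f' → g ≤ g' → f ⊗ g ≤ f' ⊗ g'
    ⊗-assoc : ∀ {w x y z} (f : Hom w x) (g : Hom x y) (k : Hom y z) →
              (f ⊗ g) ⊗ k ≡ f ⊗ (g ⊗ k)
    ⊗-idˡ   : ∀ {x y} (f : Hom x y) → idₕ x ⊗ f ≡ f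
    ⊗-idʳ   : ∀ {x y} (f : Hom x y) → f ⊗ idₕ y ≡ f
    _↙_ : ∀ {w x y} → Hom w y → Hom x y → Hom w x
    _↘_ : ∀ {x y z} → Hom x y → Hom x z → Hom y z
    ↙-adj : ∀ {w x y} (g : Hom w x) (f : Hom x y) (k : Hom w y) →
            (g ⊗ f ≤ k → g ≤ k ↙ f) × (g ≤ k ↙ f → g ⊗ f ≤ k)
    ↘-adj : ∀ {x y z} (f : Hom x y) (g : Hom y z) (k : Hom x z) →
            (f ⊗ g ≤ k → g ≤ f ↘ k) × (g ≤ f ↘ k → f ⊗ g ≤ k)

module _ {o h ℓ ι} (𝒱 : Quantaloid o h ℓ ι) where
  open Quantaloid 𝒱

  castHom : ∀ {x x' y y'} → x ≡ x' → y ≡ y' → Hom x y → Hom x' y'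
  castHom p q = subst₂ Hom p q

  record VCat : Set (o ⊔ h ⊔ ℓ ⊔ lsuc ι) where
    field
      Obj   : Set ι
      _₊    : Obj → Ob
      hom   : (a b : Obj) → Hom (a ₊) (b ₊)
      hom-id   : ∀ a → idₕ (a ₊) ≤ hom a a
      hom-comp : ∀ a b c → hom a b ⊗ hom b c ≤ hom a c

  open VCat

  record VFunctor (𝔸 𝔹 : VCat) : Set (o ⊔ h ⊔ ℓ ⊔ ι) where
    field
      fobj  : Obj 𝔸 → Obj 𝔹
      f₊    : ∀ a → (𝔸 ₊) a ≡ (𝔹 ₊) (fobj a)
      fmono : ∀ a a' → castHom (f₊ a) (f₊ a') (hom 𝔸 a a') ≤ hom 𝔹 (fobj a) (fobj a')

  open VFunctor

  _∘F_ : ∀ {𝔸 𝔹 ℂ} → VFunctor 𝔹 ℂ → VFunctor 𝔸 𝔹 → VFunctor 𝔸 ℂ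
  _∘F_ {𝔸} {𝔹} {ℂ} f p = record
    { fobj  = fobj f ∘ fobj p
    ; f₊    = λ a → trans (f₊ p a) (f₊ f (fobj p a))
    ; fmono = mono
    }
    where
    cast-trans : ∀ {x x' x'' y y' y''} (p₁ : x ≡ x') (p₂ : x' ≡ x'')
                   (q₁ : y ≡ y') (q₂ : y' ≡ y'') (k : Hom x y) →
                 castHom (trans p₁ p₂) (trans q₁ q₂) k ≡ castHom p₂ q₂ (castHom p₁ q₁ k)
    cast-trans refl refl refl refl k = refl
    mono : ∀ a a' → castHom (trans (f₊ p a) (f₊ f (fobj p a)))
                             (trans (f₊ p a') (f₊ f (fobj p a')))
                             (hom 𝔸 a a')
                    ≤ hom ℂ (fobj f (fobj p a)) (fobj f (fobj p a'))
    mono a a' = subst₂ _≤_ (sym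
                  (cast-trans (f₊ p a) (f₊ f (fobj p a)) (f₊ p a') (f₊ f (fobj p a')) (hom 𝔸 a a')))
                  refl
                  (IsPartialOrder.trans ≤-isPartialOrder
                    (castMono (f₊ f (fobj p a)) (f₊ f (fobj p a')) (fmono p a a'))
                    (fmono f (fobj p a) (fobj p a')))
      where
      castMono : ∀ {x x' y y'} (e₁ : x ≡ x') (e₂ : y ≡ y') {k k' : Hom x y} →
                 k ≤ k' → castHom e₁ e₂ k ≤ castHom e₁ e₂ k'
      castMono refl refl le = le

  -- Functional bisimulation:  𝔹(f a, b) = ⋁_{a' : f a' = b} 𝔸(a, a')
  -- (the summands are transported to the common hom-type (a₊ → b₊)).
  IsFunctionalBisimulation : ∀ {𝔸 𝔹} → VFunctor 𝔸 𝔹 → Set (h ⊔ ι)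
  IsFunctionalBisimulation {𝔸} {𝔹} F =
    ∀ (a : Obj 𝔸) (b : Obj 𝔹) →
      castHom (sym (f₊ F a)) refl (hom 𝔹 (fobj F a) b)
      ≡ ⋁ {I = Σ (Obj 𝔸) (λ a' → fobj F a' ≡ b)}
          (λ { (a' , e) → castHom refl (trans (f₊ F a') (cong (𝔹 ₊) e)) (hom 𝔸 a a') })

  SurjectiveOnObjects : ∀ {𝔸 𝔹} → VFunctor 𝔸 𝔹 → Set ι
  SurjectiveOnObjects {𝔸} {𝔹} F = ∀ (b : Obj 𝔹) → Σ (Obj 𝔸) (λ a → fobj F a ≡ b)

  InOd : ∀ {𝔸 𝔹} → VFunctor 𝔸 𝔹 → Set (h ⊔ ι)
  InOd F = IsFunctionalBisimulation F × SurjectiveOnObjects F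

{-# OPTIONS --safe #-}
module Submission where

open import Defs
open import Level using (Level)
open import Data.Product using (Σ; _,_)
open import Relation.Binary.PropositionalEquality
  using (_≡_; refl; sym; trans; cong; trans-assoc)
open import Relation.Binary.Bundles using (Poset)
import Relation.Binary.Reasoning.PartialOrder as PosetReasoning

-- Functoriality of f gives one inequality of the bisimulation equation for free.
-- For the other, write b = p a: then C(f b, c) = C(g a, c) is the join of the
-- A(a, a') over g a' = c, and each such A(a, a') lies below B(b, p a') with
-- f (p a') = c.

module _ {o h ℓ ι : Level} (𝒱 : Quantaloid o h ℓ ι) where
  open Quantaloid 𝒱
  open VCat
  open VFunctor

  homPoset : Ob → Ob → Poset h h ℓ
  homPoset x y = record { isPartialOrder = ≤-isPartialOrder {x} {y} }

  private
    variable
      x x' x'' y y' y'' : Ob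

  castHom-mono : (e₁ : x ≡ x') (e₂ : y ≡ y') {k m : Hom x y} →
                 k ≤ m → castHom 𝒱 e₁ e₂ k ≤ castHom 𝒱 e₁ e₂ m
  castHom-mono refl refl k≤m = k≤m

  castHom-cancel : (e₁ : x ≡ x') (e₂ : y ≡ y') {k m : Hom x y} →
                   castHom 𝒱 e₁ e₂ k ≤ castHom 𝒱 e₁ e₂ m → k ≤ m
  castHom-cancel refl refl k≤m = k≤m

  castHom-sym-trans : (e₁ : x ≡ x') (e₂ : x' ≡ x'') (k : Hom x'' y) →
                      castHom 𝒱 (sym (trans e₁ e₂)) refl k
                      ≡ castHom 𝒱 (sym e₁) refl (castHom 𝒱 (sym e₂) refl k)
  castHom-sym-trans refl refl k = refl

  castHom-transpose : (e₁ : x ≡ x') (e₂ : y ≡ y') (e₃ : y' ≡ y'')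
                      {k : Hom x y} {m : Hom x' y'} →
                      castHom 𝒱 e₁ e₂ k ≤ m →
                      castHom 𝒱 refl (trans e₂ e₃) k ≤ castHom 𝒱 (sym e₁) refl (castHom 𝒱 refl e₃ m)
  castHom-transpose refl refl refl k≤m = k≤m

  module _ {𝔸 𝔹 : VCat 𝒱} (F : VFunctor 𝒱 𝔸 𝔹) where

    Fiber : Obj 𝔹 → Set ι
    Fiber b = Σ (Obj 𝔸) (λ a' → fobj F a' ≡ b)

    fiberSummand : (a : Obj 𝔸) {b : Obj 𝔹} → Fiber b → Hom ((𝔸 ₊) a) ((𝔹 ₊) b)
    fiberSummand a (a' , e) = castHom 𝒱 refl (trans (f₊ F a') (cong (𝔹 ₊) e)) (hom 𝔸 a a')

    fiberJoin : (a : Obj 𝔸) (b : Obj 𝔹) → Hom ((𝔸 ₊) a) ((𝔹 ₊) b)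
    fiberJoin a b = ⋁ (fiberSummand a {b})

    homFrom : (a : Obj 𝔸) (b : Obj 𝔹) → Hom ((𝔸 ₊) a) ((𝔹 ₊) b)
    homFrom a b = castHom 𝒱 (sym (f₊ F a)) refl (hom 𝔹 (fobj F a) b)

    fmono-transposed : ∀ a a' (e : (𝔹 ₊) (fobj F a') ≡ y) →
                       castHom 𝒱 refl (trans (f₊ F a') e) (hom 𝔸 a a')
                       ≤ castHom 𝒱 (sym (f₊ F a)) refl (castHom 𝒱 refl e (hom 𝔹 (fobj F a) (fobj F a')))
    fmono-transposed a a' e = castHom-transpose (f₊ F a) (f₊ F a') e (fmono F a a')

    fiberJoin≤homFrom : ∀ a b → fiberJoin a b ≤ homFrom a b
    fiberJoin≤homFrom a b = ⋁-least _ _ summand≤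
      where
      summand≤ : (i : Fiber b) → fiberSummand a i ≤ homFrom a b
      summand≤ (a' , refl) = fmono-transposed a a' refl

    homFrom≤fiberJoin⇒isFunctionalBisimulation :
      (∀ a b → homFrom a b ≤ fiberJoin a b) → IsFunctionalBisimulation 𝒱 F
    homFrom≤fiberJoin⇒isFunctionalBisimulation le a b =
      Poset.antisym (homPoset _ _) (le a b) (fiberJoin≤homFrom a b)

  module _ {𝔸 𝔹 ℂ : VCat 𝒱} (p : VFunctor 𝒱 𝔸 𝔹) (f : VFunctor 𝒱 𝔹 ℂ) where

    fiberJoin-∘F : ∀ a c →
                   fiberJoin (_∘F_ 𝒱 f p) a c
                   ≤ castHom 𝒱 (sym (f₊ p a)) refl (fiberJoin f (fobj p a) c)
    fiberJoin-∘F a c = ⋁-least _ _ summand≤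
      where
      open PosetReasoning (homPoset ((𝔸 ₊) a) ((ℂ ₊) c))
      summand≤ : (i : Fiber (_∘F_ 𝒱 f p) c) →
                 fiberSummand (_∘F_ 𝒱 f p) a i
                 ≤ castHom 𝒱 (sym (f₊ p a)) refl (fiberJoin f (fobj p a) c)
      summand≤ (a' , e) = begin
        castHom 𝒱 refl (trans (trans (f₊ p a') (f₊ f (fobj p a'))) (cong (ℂ ₊) e)) (hom 𝔸 a a')
          ≡⟨ cong (λ q → castHom 𝒱 refl q (hom 𝔸 a a')) (trans-assoc (f₊ p a')) ⟩
        castHom 𝒱 refl (trans (f₊ p a') (trans (f₊ f (fobj p a')) (cong (ℂ ₊) e))) (hom 𝔸 a a')
          ≤⟨ fmono-transposed p a a' (trans (f₊ f (fobj p a')) (cong (ℂ ₊) e)) ⟩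
        castHom 𝒱 (sym (f₊ p a)) refl (fiberSummand f (fobj p a) (fobj p a' , e))
          ≤⟨ castHom-mono (sym (f₊ p a)) refl (⋁-upper _ (fobj p a' , e)) ⟩
        castHom 𝒱 (sym (f₊ p a)) refl (fiberJoin f (fobj p a) c) ∎

    ∘F-bisimulation⇒bisimulationˡ : IsFunctionalBisimulation 𝒱 (_∘F_ 𝒱 f p) →
                                    SurjectiveOnObjects 𝒱 p →
                                    IsFunctionalBisimulation 𝒱 f
    ∘F-bisimulation⇒bisimulationˡ g-bisim p-surj =
      homFrom≤fiberJoin⇒isFunctionalBisimulation f homFrom≤fiberJoin
      where
      homFrom≤fiberJoin : ∀ b c → homFrom f b c ≤ fiberJoin f b c
      homFrom≤fiberJoin b c with p-surj b
      ... | a , refl = castHom-cancel (sym (f₊ p a)) refl (begin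
        castHom 𝒱 (sym (f₊ p a)) refl (homFrom f (fobj p a) c)
          ≡⟨ castHom-sym-trans (f₊ p a) (f₊ f (fobj p a)) _ ⟨
        homFrom (_∘F_ 𝒱 f p) a c
          ≡⟨ g-bisim a c ⟩
        fiberJoin (_∘F_ 𝒱 f p) a c
          ≤⟨ fiberJoin-∘F a c ⟩
        castHom 𝒱 (sym (f₊ p a)) refl (fiberJoin f (fobj p a) c) ∎)
        where open PosetReasoning (homPoset ((𝔸 ₊) a) ((ℂ ₊) c))

    ∘F-surjective⇒surjectiveˡ : SurjectiveOnObjects 𝒱 (_∘F_ 𝒱 f p) → SurjectiveOnObjects 𝒱 f
    ∘F-surjective⇒surjectiveˡ g-surj c with g-surj c
    ... | a , e = fobj p a , e

mainTheorem12 : ∀ {o h ℓ ι : Level} (𝒱 : Quantaloid o h ℓ ι)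
                  {𝔸 𝔹 ℂ : VCat 𝒱}
                  (p : VFunctor 𝒱 𝔸 𝔹) (f : VFunctor 𝒱 𝔹 ℂ) →
                  InOd 𝒱 (_∘F_ 𝒱 f p) →
                  SurjectiveOnObjects 𝒱 p →
                  InOd 𝒱 f
mainTheorem12 𝒱 p f (g-bisim , g-surj) p-surj =
  ∘F-bisimulation⇒bisimulationˡ 𝒱 p f g-bisim p-surj , ∘F-surjective⇒surjectiveˡ 𝒱 p f g-surj
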